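{- Let $H$ be a complete $k$-partite graph ($k\ge 2$) with nonempty parts of sizes $n_1,\dots,n_k$ and $n=n_1+\dots+n_k$ vertices, with the shortest-path metric. If no line of $H$ equals its whole vertex set, then $k\ge 3$, $n_i\ne 2$ for all $i$, and the number of distinct lines of $H$ equals $\binom{k}{2}+\sum_{i=1}^k\binom{n_i}{2}$; moreover this number is at least $n$ and at least $\left(\tfrac{27}{32}\right)^{1/3}n^{4/3}-n$.
   Context: In a metric space $(V,dist)$, a point $v$ lies between points $u$ and $w$ if $u,v,w$ are pairwise distinct and $dist(u,v)+dist(v,w)=dist(u,w)$. For distinct points $x,y$, the line $L(xy)$ is the set consisting of $x$, $y$, and all points $z$ such that one of the three points $x,y,z$ lies between the other two. Lines of a connected graph are the lines of the metric space on its vertex set given by the shortest-path distance; distinct lines are counted as distinct sets. -}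

module Defs where

open import Data.Nat using (ℕ; zero; suc; _+_; _≤_)
open import Data.Nat.Combinatorics using (_C_)
open import Data.Fin using (Fin)
open import Data.List using (List; map; allFin)
open import Data.Nat.ListAction using (sum)
open import Data.Product using (Σ; ∃; _×_; _,_; proj₁)
open import Data.Sum using (_⊎_)
open import Relation.Nullary using (¬_)
open import Relation.Binary.PropositionalEquality using (_≡_; _≢_)
open import Function.Bundles using (_⇔_)

Σ[_]_ : (k : ℕ) → (Fin k → ℕ) → ℕ
Σ[ k ] f = sum (map f (allFin k))

-- Vertices of the complete k-partite graph with parts of sizes ns i:
-- a vertex is a pair (part index, index within the part).
Vtx : (k : ℕ) → (Fin k → ℕ) → Set
Vtx k ns = Σ (Fin k) (λ i → Fin (ns i))

module _ {k : ℕ} {ns : Fin k → ℕ} where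

  Adj : Vtx k ns → Vtx k ns → Set
  Adj u v = proj₁ u ≢ proj₁ v

  data Walk : Vtx k ns → Vtx k ns → ℕ → Set where
    here : ∀ {u} → Walk u u zero
    step : ∀ {u v w d} → Adj u v → Walk v w d → Walk u w (suc d)

  Dist : Vtx k ns → Vtx k ns → ℕ → Set
  Dist u v d = Walk u v d × (∀ d' → Walk u v d' → d ≤ d')

  Between : Vtx k ns → Vtx k ns → Vtx k ns → Set
  Between u v w =
    u ≢ v × v ≢ w × u ≢ w ×
    ∃ λ a → ∃ λ b → ∃ λ c → Dist u v a × Dist v w b × Dist u w c × (a + b ≡ c)

  InLine : Vtx k ns → Vtx k ns → Vtx k ns → Set
  InLine x y z =
    z ≡ x ⊎ z ≡ y ⊎ Between x z y ⊎ Between z x y ⊎ Between x y z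

  SameSet : (Vtx k ns → Set) → (Vtx k ns → Set) → Set
  SameSet A B = ∀ z → A z ⇔ B z

  -- The graph has exactly N distinct lines: an enumeration of N lines L(xy)
  -- (x ≠ y), pairwise distinct as sets, covering every line.
  NumLines : ℕ → Set
  NumLines N =
    Σ (Fin N → Vtx k ns × Vtx k ns) λ f →
      (∀ i → proj₁ (f i) ≢ Data.Product.proj₂ (f i)) ×
      (∀ i j → i ≢ j →
         ¬ SameSet (InLine (proj₁ (f i)) (Data.Product.proj₂ (f i)))
                   (InLine (proj₁ (f j)) (Data.Product.proj₂ (f j)))) ×
      (∀ x y → x ≢ y → ∃ λ i →
         SameSet (InLine x y)
                 (InLine (proj₁ (f i)) (Data.Product.proj₂ (f i))))

-- Distinct vertices of a complete multipartite graph are at distance 1 (different parts) or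
-- 2 (same part), so v lies between u and w exactly when u and w share a part that v avoids.
-- Hence the line through vertices of parts i ≠ j is the union of these two parts, and the line
-- through x ≠ y of part i is {x, y} together with everything outside part i. For k = 2, or for
-- a part of size 2, one of these lines is the whole vertex set. Otherwise the lines are pairwise
-- distinct (a third part, resp. a third vertex of a part, tells them apart), so there are
-- C(k,2) + Σ C(nᵢ,2) of them. For the bounds, nᵢ ≤ C(nᵢ,2) + 1 and k ≤ C(k,2) give n ≤ N;
-- and 2(N + n) ≥ k² + Σ nᵢ² ≥ k² + n²/k by Cauchy–Schwarz, so AM–GM in the form
-- 27 a c² ≤ 4 (a + c)³ with a = k³, c = n² yields 27 n⁴ ≤ 4 (2(N + n))³.

module Submission where

open import Defs
open import Data.Nat using (ℕ; zero; suc; _+_; _*_; _^_; _≤_; z≤n; s≤s; z<s; s<s; NonZero; >-nonZero)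
open import Data.Nat.Properties
  using (≤-antisym; ≤-trans; ≤-total; ≤∧≢⇒<; 1+n≰n; m≤m+n; m≤n⇒∃[o]m+o≡n; module ≤-Reasoning
        ; +-comm; +-mono-≤; +-monoʳ-≤; +-cancelʳ-≤; *-zeroʳ; *-identityʳ; *-distribˡ-+
        ; *-monoʳ-≤; *-cancelˡ-≤; ^-monoˡ-≤; m*n≢0)
open import Data.Nat.Tactic.RingSolver using (solve-∀)
open import Data.Nat.Combinatorics using (_C_; nC1≡n; nCk+nC[k+1]≡[n+1]C[k+1])
open import Data.Nat.ListAction using (sum)
open import Data.Fin using (Fin; zero; suc; _<_; fromℕ<) renaming (_≟_ to _≟ᶠ_)
open import Data.Fin.Properties using (suc-injective; <-cmp; <⇒≢; <-irrefl; <-trans)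
open import Data.List using (List; []; _∷_; map; allFin; _++_; length; lookup; concatMap)
open import Data.List.Properties using (length-map; length-++; length-tabulate; map-cong)
open import Data.List.Membership.Propositional using (_∈_; find; lose)
open import Data.List.Membership.Propositional.Properties
  using (∈-map⁻; ∈-map⁺; ∈-++⁻; ∈-++⁺ˡ; ∈-++⁺ʳ; ∈-allFin; ∈-lookup; ∈-concatMap⁻; ∈-concatMap⁺)
open import Data.List.Relation.Unary.All as All using (All)
import Data.List.Relation.Unary.All.Properties as All
import Data.List.Relation.Unary.AllPairs as AllPairs
import Data.List.Relation.Unary.AllPairs.Properties as AllPairs
open import Data.List.Relation.Unary.Any using (index)
open import Data.List.Relation.Unary.Any.Properties using (lookup-index)
open import Data.List.Relation.Unary.Unique.Propositional using (Unique; _∷_)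
import Data.List.Relation.Unary.Unique.Propositional.Properties as Unique
open import Data.List.Relation.Binary.Disjoint.Propositional using (Disjoint)
open import Data.Product using (∃; ∃₂; _×_; _,_; proj₁; proj₂)
import Data.Product as Product
open import Data.Product.Properties using (≡-dec; ,-injectiveʳ)
open import Data.Sum using (_⊎_; inj₁; inj₂)
import Data.Sum as Sum
open import Data.Empty using (⊥-elim)
open import Function.Base using (_∘_; it)
open import Function.Bundles using (_⇔_; mk⇔; module Equivalence)
open import Function.Construct.Composition using (_⇔-∘_)
open import Function.Construct.Symmetry using (⇔-sym)
open import Function.Construct.Identity using (⇔-id)
open import Relation.Nullary using (¬_; yes; no; Dec)
open import Relation.Binary using (tri<; tri≈; tri>)
open import Relation.Binary.PropositionalEquality
  using (_≡_; _≢_; refl; sym; trans; cong; cong₂; subst; module ≡-Reasoning)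

-- Arithmetic

[1+n]C2≡n+nC2 : ∀ n → suc n C 2 ≡ n + n C 2
[1+n]C2≡n+nC2 n = begin
  suc n C 2     ≡⟨ nCk+nC[k+1]≡[n+1]C[k+1] n 1 ⟨
  n C 1 + n C 2 ≡⟨ cong (_+ n C 2) (nC1≡n n) ⟩
  n + n C 2     ∎
  where open ≡-Reasoning

2*nC2+n≡n*n : ∀ n → 2 * (n C 2) + n ≡ n * n
2*nC2+n≡n*n zero    = refl
2*nC2+n≡n*n (suc n) = begin
  2 * (suc n C 2) + suc n      ≡⟨ cong (λ c → 2 * c + suc n) ([1+n]C2≡n+nC2 n) ⟩
  2 * (n + n C 2) + suc n      ≡⟨ regroup n (n C 2) ⟩
  (2 * (n C 2) + n) + 2 * n + 1 ≡⟨ cong (λ m → m + 2 * n + 1) (2*nC2+n≡n*n n) ⟩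
  n * n + 2 * n + 1            ≡⟨ square n ⟩
  suc n * suc n                ∎
  where
  open ≡-Reasoning
  regroup : ∀ n c → 2 * (n + c) + suc n ≡ (2 * c + n) + 2 * n + 1
  regroup = solve-∀
  square : ∀ n → n * n + 2 * n + 1 ≡ suc n * suc n
  square = solve-∀

n≤nC2+1 : ∀ n → n ≤ n C 2 + 1
n≤nC2+1 zero    = z≤n
n≤nC2+1 (suc n) = subst (suc n ≤_) (sym suc-nC2+1) (s≤s (m≤m+n n (n C 2)))
  where
  suc-nC2+1 : suc n C 2 + 1 ≡ suc (n + n C 2)
  suc-nC2+1 = trans (+-comm (suc n C 2) 1) (cong suc ([1+n]C2≡n+nC2 n))

3≤n⇒n≤nC2 : ∀ {n} → 3 ≤ n → n ≤ n C 2
3≤n⇒n≤nC2 {1} (s≤s ())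
3≤n⇒n≤nC2 {2} (s≤s (s≤s ()))
3≤n⇒n≤nC2 {suc (suc (suc j))} _ = begin
  3 + j                                    ≡⟨ +-comm 1 (2 + j) ⟩
  (2 + j) + 1                              ≤⟨ +-monoʳ-≤ (2 + j) (m≤m+n 1 (j + suc j C 2)) ⟩
  (2 + j) + (1 + j + suc j C 2)            ≡⟨ cong ((2 + j) +_) ([1+n]C2≡n+nC2 (suc j)) ⟨
  (2 + j) + suc (suc j) C 2                ≡⟨ [1+n]C2≡n+nC2 (suc (suc j)) ⟨
  suc (suc (suc j)) C 2                    ∎
  where open ≤-Reasoning

module _ {A : Set} where

  sum-map-mono : {f g : A → ℕ} → (∀ x → f x ≤ g x) → ∀ xs → sum (map f xs) ≤ sum (map g xs)
  sum-map-mono f≤g []       = z≤n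
  sum-map-mono f≤g (x ∷ xs) = +-mono-≤ (f≤g x) (sum-map-mono f≤g xs)

  sum-map-+ : (f g : A → ℕ) → ∀ xs → sum (map (λ x → f x + g x) xs) ≡ sum (map f xs) + sum (map g xs)
  sum-map-+ f g []       = refl
  sum-map-+ f g (x ∷ xs) = trans (cong (f x + g x +_) (sum-map-+ f g xs))
                                 (+-assoc-comm (f x) (g x) (sum (map f xs)) (sum (map g xs)))
    where
    +-assoc-comm : ∀ a b c d → a + b + (c + d) ≡ a + c + (b + d)
    +-assoc-comm = solve-∀

  sum-map-*ˡ : ∀ c (f : A → ℕ) xs → sum (map (λ x → c * f x) xs) ≡ c * sum (map f xs)
  sum-map-*ˡ c f []       = sym (*-zeroʳ c)
  sum-map-*ˡ c f (x ∷ xs) = trans (cong (c * f x +_) (sum-map-*ˡ c f xs)) (sym (*-distribˡ-+ c (f x) _))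

  sum-map-const : ∀ c xs → sum (map (λ (_ : A) → c) xs) ≡ length xs * c
  sum-map-const c []       = refl
  sum-map-const c (x ∷ xs) = cong (c +_) (sum-map-const c xs)

2*m*n≤m*m+n*n : ∀ m n → 2 * m * n ≤ m * m + n * n
2*m*n≤m*m+n*n m n with ≤-total m n
... | inj₁ m≤n with m≤n⇒∃[o]m+o≡n m≤n
...   | d , refl = subst (2 * m * (m + d) ≤_) (sym (gap m d)) (m≤m+n _ _)
  where
  gap : ∀ m d → m * m + (m + d) * (m + d) ≡ 2 * m * (m + d) + d * d
  gap = solve-∀
2*m*n≤m*m+n*n m n | inj₂ n≤m with m≤n⇒∃[o]m+o≡n n≤m
...   | d , refl = subst (2 * (n + d) * n ≤_) (sym (gap n d)) (m≤m+n _ _)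
  where
  gap : ∀ n d → (n + d) * (n + d) + n * n ≡ 2 * (n + d) * n + d * d
  gap = solve-∀

module _ {A : Set} (f : A → ℕ) where

  private
    Σf Σf² : List A → ℕ
    Σf  xs = sum (map f xs)
    Σf² xs = sum (map (λ x → f x * f x) xs)

  cross-term-≤ : ∀ u xs → 2 * u * Σf xs ≤ Σf² xs + length xs * (u * u)
  cross-term-≤ u xs = begin
    2 * u * Σf xs                                    ≡⟨ sum-map-*ˡ (2 * u) f xs ⟨
    sum (map (λ x → 2 * u * f x) xs)                 ≤⟨ sum-map-mono (λ x → 2*m*n≤m*m+n*n u (f x)) xs ⟩
    sum (map (λ x → u * u + f x * f x) xs)           ≡⟨ sum-map-+ (λ _ → u * u) (λ x → f x * f x) xs ⟩
    sum (map (λ _ → u * u) xs) + Σf² xs              ≡⟨ cong (_+ Σf² xs) (sum-map-const (u * u) xs) ⟩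
    length xs * (u * u) + Σf² xs                     ≡⟨ +-comm _ (Σf² xs) ⟩
    Σf² xs + length xs * (u * u)                     ∎
    where open ≤-Reasoning

  cauchy-schwarz : ∀ xs → Σf xs * Σf xs ≤ length xs * Σf² xs
  cauchy-schwarz []       = z≤n
  cauchy-schwarz (x ∷ xs) = begin
    (f x + Σf xs) * (f x + Σf xs)                                 ≡⟨ expand (f x) (Σf xs) ⟩
    f x * f x + 2 * f x * Σf xs + Σf xs * Σf xs                   ≤⟨ +-mono-≤ (+-monoʳ-≤ (f x * f x) (cross-term-≤ (f x) xs))
                                                                               (cauchy-schwarz xs) ⟩
    f x * f x + (Σf² xs + length xs * (f x * f x)) + length xs * Σf² xs ≡⟨ collect (f x) (Σf² xs) (length xs) ⟩
    suc (length xs) * (f x * f x + Σf² xs)                         ∎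
    where
    open ≤-Reasoning
    expand : ∀ y s → (y + s) * (y + s) ≡ y * y + 2 * y * s + s * s
    expand = solve-∀
    collect : ∀ y q l → y * y + (q + l * (y * y)) + l * q ≡ suc l * (y * y + q)
    collect = solve-∀

-- 4 (a + c)³ − 27 a c² = (c − 2a)² (a + 4c); each case writes the larger of c and 2a as the
-- smaller plus d, the second after doubling to clear the factor 2 in front of a.
27*a*c²≤4*[a+c]³ : ∀ a c → 27 * a * (c * c) ≤ 4 * (a + c) ^ 3
27*a*c²≤4*[a+c]³ a c with ≤-total (2 * a) c
... | inj₁ 2a≤c with m≤n⇒∃[o]m+o≡n 2a≤c
...   | d , refl = subst (27 * a * ((2 * a + d) * (2 * a + d)) ≤_) (sym (gap a d)) (m≤m+n _ _)
  where
  gap : ∀ a d → 4 * ((a + (2 * a + d)) * ((a + (2 * a + d)) * ((a + (2 * a + d)) * 1))) ≡ 27 * a * ((2 * a + d) * (2 * a + d)) + d * d * (a + 4 * (2 * a + d))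
  gap = solve-∀
27*a*c²≤4*[a+c]³ a c | inj₂ c≤2a with m≤n⇒∃[o]m+o≡n c≤2a
...   | d , c+d≡2a = *-cancelˡ-≤ 8 (begin
  8 * (27 * a * (c * c))                           ≡⟨ regroup a c ⟩
  108 * (2 * a) * (c * c)                          ≡⟨ cong (λ t → 108 * t * (c * c)) c+d≡2a ⟨
  108 * (c + d) * (c * c)                          ≤⟨ m≤m+n _ _ ⟩
  108 * (c + d) * (c * c) + d * d * (36 * c + 4 * d) ≡⟨ gap c d ⟩
  4 * ((c + d) + 2 * c) ^ 3                        ≡⟨ cong (λ t → 4 * (t + 2 * c) ^ 3) c+d≡2a ⟩
  4 * (2 * a + 2 * c) ^ 3                          ≡⟨ double a c ⟩
  8 * (4 * (a + c) ^ 3)                            ∎)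
  where
  open ≤-Reasoning
  regroup : ∀ a c → 8 * (27 * a * (c * c)) ≡ 108 * (2 * a) * (c * c)
  regroup = solve-∀
  gap : ∀ c d → 108 * (c + d) * (c * c) + d * d * (36 * c + 4 * d) ≡ 4 * ((c + d + 2 * c) * ((c + d + 2 * c) * ((c + d + 2 * c) * 1)))
  gap = solve-∀
  double : ∀ a c → 4 * ((2 * a + 2 * c) * ((2 * a + 2 * c) * ((2 * a + 2 * c) * 1))) ≡ 8 * (4 * ((a + c) * ((a + c) * ((a + c) * 1))))
  double = solve-∀

27*n⁴≤32*M³ : ∀ k n s M .{{_ : NonZero k}} → n * n ≤ k * s → k * k + s ≤ 2 * M →
  27 * n ^ 4 ≤ 32 * M ^ 3
27*n⁴≤32*M³ k n s M n²≤ks k²+s≤2M = *-cancelˡ-≤ (k * (k * k)) {{m*n≢0 k (k * k) {{it}} {{m*n≢0 k k}}}} (begin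
  k * (k * k) * (27 * n ^ 4)             ≡⟨ regroup k n ⟩
  27 * (k * (k * k)) * ((n * n) * (n * n)) ≤⟨ 27*a*c²≤4*[a+c]³ (k * (k * k)) (n * n) ⟩
  4 * (k * (k * k) + n * n) ^ 3           ≤⟨ *-monoʳ-≤ 4 (^-monoˡ-≤ 3 k³+n²≤2kM) ⟩
  4 * (k * (2 * M)) ^ 3                   ≡⟨ cube k M ⟩
  k * (k * k) * (32 * M ^ 3)              ∎)
  where
  open ≤-Reasoning
  k³+n²≤2kM : k * (k * k) + n * n ≤ k * (2 * M)
  k³+n²≤2kM = begin
    k * (k * k) + n * n ≤⟨ +-monoʳ-≤ (k * (k * k)) n²≤ks ⟩
    k * (k * k) + k * s ≡⟨ *-distribˡ-+ k (k * k) s ⟨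
    k * (k * k + s)     ≤⟨ *-monoʳ-≤ k k²+s≤2M ⟩
    k * (2 * M)         ∎
  regroup : ∀ k n → k * (k * k) * (27 * (n * (n * (n * (n * 1))))) ≡ 27 * (k * (k * k)) * ((n * n) * (n * n))
  regroup = solve-∀
  cube : ∀ k M → 4 * ((k * (2 * M)) * ((k * (2 * M)) * ((k * (2 * M)) * 1))) ≡ k * (k * k) * (32 * (M * (M * (M * 1))))
  cube = solve-∀

-- Finite sets and lists

third-element : ∀ {n} (a b : Fin n) → a ≢ b → n ≢ 2 → ∃ λ c → c ≢ a × c ≢ b
third-element {1} zero zero a≢b _ = ⊥-elim (a≢b refl)
third-element {2} _ _ _ n≢2 = ⊥-elim (n≢2 refl)
third-element {suc (suc (suc _))} zero          zero          _ _ = suc zero , (λ ()) , (λ ())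
third-element {suc (suc (suc _))} zero          (suc zero)    _ _ = suc (suc zero) , (λ ()) , (λ ())
third-element {suc (suc (suc _))} zero          (suc (suc _)) _ _ = suc zero , (λ ()) , (λ ())
third-element {suc (suc (suc _))} (suc zero)    zero          _ _ = suc (suc zero) , (λ ()) , (λ ())
third-element {suc (suc (suc _))} (suc zero)    (suc _)       _ _ = zero , (λ ()) , (λ ())
third-element {suc (suc (suc _))} (suc (suc _)) zero          _ _ = suc zero , (λ ()) , (λ ())
third-element {suc (suc (suc _))} (suc (suc _)) (suc _)       _ _ = zero , (λ ()) , (λ ())

Fin-two : ∀ {n} → n ≡ 2 → ∃₂ λ (a b : Fin n) → a ≢ b × ∀ c → c ≡ a ⊎ c ≡ b
Fin-two refl = zero , suc zero , (λ ()) , λ { zero → inj₁ refl ; (suc zero) → inj₂ refl }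

<-pair-unique : ∀ {n} {a b a′ b′ : Fin n} → a < b → a′ < b′ →
  a ≡ a′ ⊎ a ≡ b′ → b ≡ a′ ⊎ b ≡ b′ → a ≡ a′ × b ≡ b′
<-pair-unique a<b a′<b′ (inj₁ refl) (inj₁ refl) = ⊥-elim (<-irrefl refl a<b)
<-pair-unique a<b a′<b′ (inj₁ refl) (inj₂ refl) = refl , refl
<-pair-unique a<b a′<b′ (inj₂ refl) (inj₁ refl) = ⊥-elim (<-irrefl refl (<-trans a′<b′ a<b))
<-pair-unique a<b a′<b′ (inj₂ refl) (inj₂ refl) = ⊥-elim (<-irrefl refl a<b)

lookup-injective : {A : Set} {xs : List A} → Unique xs → ∀ i j → lookup xs i ≡ lookup xs j → i ≡ j
lookup-injective (_    ∷ _)   zero    zero    _  = refl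
lookup-injective (x∉xs ∷ _)   zero    (suc j) eq = ⊥-elim (All.lookup x∉xs (∈-lookup j) eq)
lookup-injective (x∉xs ∷ _)   (suc i) zero    eq = ⊥-elim (All.lookup x∉xs (∈-lookup i) (sym eq))
lookup-injective (_    ∷ xs!) (suc i) (suc j) eq = cong suc (lookup-injective xs! i j eq)

module _ {A B : Set} where

  length-concatMap : (g : A → List B) (xs : List A) → length (concatMap g xs) ≡ sum (map (length ∘ g) xs)
  length-concatMap g []       = refl
  length-concatMap g (x ∷ xs) = trans (length-++ (g x)) (cong (length (g x) +_) (length-concatMap g xs))

  concatMap-unique : (g : A → List B) → (∀ x → Unique (g x)) →
    (∀ {x y} → x ≢ y → Disjoint (g x) (g y)) → {xs : List A} → Unique xs → Unique (concatMap g xs)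
  concatMap-unique g g! g# {xs} xs! =
    Unique.concat⁺ (All.map⁺ (All.universal g! xs)) (AllPairs.map⁺ (AllPairs.map g# xs!))

pairs : (n : ℕ) → List (Fin n × Fin n)
pairs zero    = []
pairs (suc n) = map (λ j → zero , suc j) (allFin n) ++ map (Product.map suc suc) (pairs n)

∈-pairs⁻ : ∀ n {a b : Fin n} → (a , b) ∈ pairs n → a < b
∈-pairs⁻ (suc n) ab∈ with ∈-++⁻ (map (λ j → zero , suc j) (allFin n)) ab∈
... | inj₁ ab∈₁ with ∈-map⁻ (λ j → Fin.zero {n} , suc j) ab∈₁
...   | _ , _ , refl = z<s
∈-pairs⁻ (suc n) ab∈ | inj₂ ab∈₂ with ∈-map⁻ (Product.map suc suc) ab∈₂
...   | _ , ab∈′ , refl = s<s (∈-pairs⁻ n ab∈′)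

∈-pairs⁺ : ∀ n {a b : Fin n} → a < b → (a , b) ∈ pairs n
∈-pairs⁺ (suc n) {zero}  {suc b} _         = ∈-++⁺ˡ (∈-map⁺ (λ j → zero , suc j) (∈-allFin b))
∈-pairs⁺ (suc n) {suc a} {suc b} (s<s a<b) =
  ∈-++⁺ʳ (map (λ j → zero , suc j) (allFin n)) (∈-map⁺ (Product.map suc suc) (∈-pairs⁺ n a<b))

pairs-unique : ∀ n → Unique (pairs n)
pairs-unique zero    = Unique.[]
pairs-unique (suc n) =
  Unique.++⁺ (Unique.map⁺ (suc-injective ∘ ,-injectiveʳ) (Unique.allFin⁺ n))
             (Unique.map⁺ suc×suc-injective (pairs-unique n))
             first≠later
  where
  suc×suc-injective : {p q : Fin n × Fin n} → Product.map suc suc p ≡ Product.map suc suc q → p ≡ q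
  suc×suc-injective {_ , _} {_ , _} refl = refl
  first≠later : Disjoint (map (λ j → zero , suc j) (allFin n)) (map (Product.map suc suc) (pairs n))
  first≠later (v∈first , v∈later) with ∈-map⁻ (λ j → Fin.zero {n} , suc j) v∈first
                                    | ∈-map⁻ (λ (p : Fin n × Fin n) → Product.map suc suc p) v∈later
  ... | _ , _ , refl | _ , _ , ()

length-pairs : ∀ n → length (pairs n) ≡ n C 2
length-pairs zero    = refl
length-pairs (suc n) = begin
  length (map (λ j → zero , suc j) (allFin n) ++ map (Product.map suc suc) (pairs n))
    ≡⟨ length-++ (map (λ j → zero , suc j) (allFin n)) ⟩
  length (map (λ j → zero , suc j) (allFin n)) + length (map (Product.map suc suc) (pairs n))
    ≡⟨ cong₂ _+_ (trans (length-map _ (allFin n)) (length-tabulate _))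
                 (trans (length-map _ (pairs n)) (length-pairs n)) ⟩
  n + n C 2
    ≡⟨ [1+n]C2≡n+nC2 n ⟨
  suc n C 2 ∎
  where open ≡-Reasoning

-- Distances and lines of a complete multipartite graph

module _ {k : ℕ} {ns : Fin k → ℕ} where

  private
    V = Vtx k ns
    Walkᵥ = Walk {k} {ns}
    Distᵥ = Dist {k} {ns}
    InLineᵥ = InLine {k} {ns}

  _≟ᵛ_ : (u v : V) → Dec (u ≡ v)
  _≟ᵛ_ = ≡-dec _≟ᶠ_ _≟ᶠ_

  vertex-injectiveʳ : {i : Fin k} {a b : Fin (ns i)} → _≡_ {A = V} (i , a) (i , b) → a ≡ b
  vertex-injectiveʳ refl = refl

  Adj⇒≢ : {u v : V} → Adj u v → u ≢ v
  Adj⇒≢ u~v refl = u~v refl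

  walk-zero : {u v : V} → Walkᵥ u v 0 → u ≡ v
  walk-zero here = refl

  walk-one : {u v : V} → Walkᵥ u v 1 → Adj u v
  walk-one (step u~v here) = u~v

  walk-neighbour : ∀ {u v : V} {d} → u ≢ v → Walkᵥ u v d → ∃ λ x → Adj u x
  walk-neighbour u≢u here                 = ⊥-elim (u≢u refl)
  walk-neighbour _   (step {v = x} u~x _) = x , u~x

  Dist-unique : ∀ {u v : V} {a b} → Distᵥ u v a → Distᵥ u v b → a ≡ b
  Dist-unique (wa , mina) (wb , minb) = ≤-antisym (mina _ wb) (minb _ wa)

  Dist-pos : ∀ {u v : V} {d} → u ≢ v → Distᵥ u v d → 1 ≤ d
  Dist-pos {d = zero}  u≢v (w , _) = ⊥-elim (u≢v (walk-zero w))
  Dist-pos {d = suc d} u≢v _       = s≤s z≤n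

  Dist-adj : {u v : V} → Adj u v → Distᵥ u v 1
  Dist-adj {u} {v} u~v = step u~v here , minimal
    where
    minimal : ∀ d → Walkᵥ u v d → 1 ≤ d
    minimal zero    w = ⊥-elim (Adj⇒≢ u~v (walk-zero w))
    minimal (suc d) w = s≤s z≤n

  Dist-two : {u w : V} (x : V) → Adj u x → Adj x w → proj₁ u ≡ proj₁ w → u ≢ w → Distᵥ u w 2
  Dist-two {u} {w} x u~x x~w u≈w u≢w = step {v = x} u~x (step x~w here) , minimal
    where
    minimal : ∀ d → Walkᵥ u w d → 2 ≤ d
    minimal zero          p = ⊥-elim (u≢w (walk-zero p))
    minimal (suc zero)    p = ⊥-elim (walk-one p u≈w)
    minimal (suc (suc d)) p = s≤s (s≤s z≤n)

  -- Distinct vertices are at distance 1 across parts and 2 within a part (through any vertex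
  -- of another part, e.g. the first step of a walk out of u), so a + b = c forces 1 + 1 = 2.
  between⇒ : {u v w : V} → Between u v w → u ≢ w × proj₁ u ≡ proj₁ w × Adj u v
  between⇒ {u} {v} {w} (u≢v , v≢w , u≢w , a , b , c , duv , dvw , duw , a+b≡c)
    with proj₁ u ≟ᶠ proj₁ w | proj₁ u ≟ᶠ proj₁ v
  ... | no u~w | _ = ⊥-elim (1+n≰n (subst (2 ≤_) (trans a+b≡c c≡1) 2≤a+b))
    where
    c≡1 = Dist-unique duw (Dist-adj u~w)
    2≤a+b = +-mono-≤ (Dist-pos u≢v duv) (Dist-pos v≢w dvw)
  ... | yes u≈w | no u~v = u≢w , u≈w , u~v
  ... | yes u≈w | yes u≈v with walk-neighbour u≢v (proj₁ duv)
  ... | x , u~x = ⊥-elim (1+n≰n (subst (3 ≤_) (trans a+b≡c c≡2) 3≤a+b))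
    where
    x-adjacent : (y : V) → proj₁ u ≡ proj₁ y → Adj x y
    x-adjacent _ u≈y x≈y = u~x (trans u≈y (sym x≈y))
    c≡2 = Dist-unique duw (Dist-two x u~x (x-adjacent w u≈w) u≈w u≢w)
    a≡2 = Dist-unique duv (Dist-two x u~x (x-adjacent v u≈v) u≈v u≢v)
    3≤a+b = subst (λ a → 3 ≤ a + b) (sym a≡2) (+-mono-≤ (s≤s (s≤s z≤n)) (Dist-pos v≢w dvw))

  between⇐ : {u w : V} (v : V) → u ≢ w → proj₁ u ≡ proj₁ w → Adj u v → Between u v w
  between⇐ v u≢w u≈w u~v =
    Adj⇒≢ u~v , Adj⇒≢ v~w , u≢w , 1 , 1 , 2 , Dist-adj u~v , Dist-adj v~w , Dist-two v u~v v~w u≈w u≢w , refl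
    where
    v~w = λ v≈w → u~v (trans u≈w (sym v≈w))

  line-across : {x y : V} → Adj x y → ∀ z → InLineᵥ x y z ⇔ (proj₁ z ≡ proj₁ x ⊎ proj₁ z ≡ proj₁ y)
  line-across {x} {y} x~y z = mk⇔ to from
    where
    to : InLineᵥ x y z → proj₁ z ≡ proj₁ x ⊎ proj₁ z ≡ proj₁ y
    to (inj₁ refl)                     = inj₁ refl
    to (inj₂ (inj₁ refl))              = inj₂ refl
    to (inj₂ (inj₂ (inj₁ xzy)))        = let _ , x≈y , _ = between⇒ xzy in ⊥-elim (x~y x≈y)
    to (inj₂ (inj₂ (inj₂ (inj₁ zxy)))) = let _ , z≈y , _ = between⇒ zxy in inj₂ z≈y
    to (inj₂ (inj₂ (inj₂ (inj₂ xyz)))) = let _ , x≈z , _ = between⇒ xyz in inj₁ (sym x≈z)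
    from : proj₁ z ≡ proj₁ x ⊎ proj₁ z ≡ proj₁ y → InLineᵥ x y z
    from (inj₁ z≈x) with z ≟ᵛ x
    ... | yes z≡x = inj₁ z≡x
    ... | no z≢x  = inj₂ (inj₂ (inj₂ (inj₂ (between⇐ y (λ x≡z → z≢x (sym x≡z)) (sym z≈x) x~y))))
    from (inj₂ z≈y) with z ≟ᵛ y
    ... | yes z≡y = inj₂ (inj₁ z≡y)
    ... | no z≢y  = inj₂ (inj₂ (inj₂ (inj₁ (between⇐ x z≢y z≈y (λ z≈x → x~y (trans (sym z≈x) z≈y))))))

  line-within : {x y : V} → x ≢ y → proj₁ x ≡ proj₁ y → ∀ z → InLineᵥ x y z ⇔ (z ≡ x ⊎ z ≡ y ⊎ Adj x z)
  line-within {x} {y} x≢y x≈y z = mk⇔ to from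
    where
    to : InLineᵥ x y z → z ≡ x ⊎ z ≡ y ⊎ Adj x z
    to (inj₁ z≡x)                      = inj₁ z≡x
    to (inj₂ (inj₁ z≡y))               = inj₂ (inj₁ z≡y)
    to (inj₂ (inj₂ (inj₁ xzy)))        = let _ , _ , x~z = between⇒ xzy in inj₂ (inj₂ x~z)
    to (inj₂ (inj₂ (inj₂ (inj₁ zxy)))) = let _ , z≈y , z~x = between⇒ zxy in ⊥-elim (z~x (trans z≈y (sym x≈y)))
    to (inj₂ (inj₂ (inj₂ (inj₂ xyz)))) = let _ , _ , x~y = between⇒ xyz in ⊥-elim (x~y x≈y)
    from : z ≡ x ⊎ z ≡ y ⊎ Adj x z → InLineᵥ x y z
    from (inj₁ z≡x)          = inj₁ z≡x
    from (inj₂ (inj₁ z≡y))   = inj₂ (inj₁ z≡y)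
    from (inj₂ (inj₂ x~z))   = inj₂ (inj₂ (inj₁ (between⇐ z x≢y x≈y x~z)))

  LineOf : V × V → V → Set
  LineOf p = InLineᵥ (proj₁ p) (proj₂ p)

  SameLine : V × V → V × V → Set
  SameLine p q = SameSet (LineOf p) (LineOf q)

  line-reverse : {x y : V} → x ≢ y → ∀ z → LineOf (x , y) z → LineOf (y , x) z
  line-reverse {x} {y} x≢y z with proj₁ x ≟ᶠ proj₁ y
  ... | no x~y = Equivalence.from (line-across (λ y≈x → x~y (sym y≈x)) z)
             ∘ Sum.swap ∘ Equivalence.to (line-across x~y z)
  ... | yes x≈y = Equivalence.from (line-within (λ y≡x → x≢y (sym y≡x)) (sym x≈y) z)
              ∘ Sum.[ inj₂ ∘ inj₁ , Sum.[ inj₁ , (λ x~z → inj₂ (inj₂ (λ y≈z → x~z (trans x≈y y≈z)))) ] ]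
              ∘ Equivalence.to (line-within x≢y x≈y z)

  line-sym : {x y : V} → x ≢ y → SameLine (x , y) (y , x)
  line-sym x≢y z = mk⇔ (line-reverse x≢y z) (line-reverse (λ y≡x → x≢y (sym y≡x)) z)

  line-across-parts : {x y x′ y′ : V} → Adj x y → Adj x′ y′ →
    proj₁ x ≡ proj₁ x′ → proj₁ y ≡ proj₁ y′ → SameLine (x , y) (x′ , y′)
  line-across-parts x~y x′~y′ refl refl z = ⇔-sym (line-across x′~y′ z) ⇔-∘ line-across x~y z

  SameLine-trans : {p q r : V × V} → SameLine p q → SameLine q r → SameLine p r
  SameLine-trans p∼q q∼r z = q∼r z ⇔-∘ p∼q z

  FullLine : Set
  FullLine = ∃₂ λ (x y : V) → x ≢ y × ∀ z → InLineᵥ x y z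

  FullLine-of-pair-part : (i : Fin k) → ns i ≡ 2 → FullLine
  FullLine-of-pair-part i nsᵢ≡2 with Fin-two nsᵢ≡2
  ... | a , b , a≢b , a∨b =
    (i , a) , (i , b) , a≢b ∘ vertex-injectiveʳ ,
    λ z → Equivalence.from (line-within (a≢b ∘ vertex-injectiveʳ) refl z) (classify z)
    where
    classify : ∀ z → z ≡ (i , a) ⊎ z ≡ (i , b) ⊎ Adj (i , a) z
    classify (j , c) with i ≟ᶠ j
    ... | no i≢j   = inj₂ (inj₂ i≢j)
    ... | yes refl = Sum.map (cong (i ,_)) (inj₁ ∘ cong (i ,_)) (a∨b c)

  NumLines-fromList : (L : List (V × V)) → Unique L →
    (∀ {p} → p ∈ L → proj₁ p ≢ proj₂ p) →
    (∀ {p q} → p ∈ L → q ∈ L → SameLine p q → p ≡ q) →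
    (∀ {x y} → x ≢ y → ∃ λ p → p ∈ L × SameLine (x , y) p) →
    NumLines {k} {ns} (length L)
  NumLines-fromList L L! distinct sameLine⇒≡ cover =
    lookup L ,
    (λ i → distinct (∈-lookup i)) ,
    (λ i j i≢j i∼j → i≢j (lookup-injective L! i j (sameLine⇒≡ (∈-lookup i) (∈-lookup j) i∼j))) ,
    λ x y x≢y → let p , p∈L , xy∼p = cover x≢y in
      index p∈L , subst (SameLine (x , y)) (lookup-index p∈L) xy∼p

  module _ (v₀ : (i : Fin k) → Fin (ns i)) where

    -- A line across parts i < j depends only on i and j, so it is represented through the
    -- chosen vertices v₀; a line inside a part is represented by its endpoints in order.
    data Canonical : V × V → Set where
      across : {i j : Fin k} → i < j → Canonical ((i , v₀ i) , (j , v₀ j))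
      within : {i : Fin k} {a b : Fin (ns i)} → a < b → Canonical ((i , a) , (i , b))

    canonical-distinct : {p : V × V} → Canonical p → proj₁ p ≢ proj₂ p
    canonical-distinct (across i<j) = <⇒≢ i<j ∘ cong proj₁
    canonical-distinct (within a<b) = <⇒≢ a<b ∘ vertex-injectiveʳ

    canonical-cover : {x y : V} → x ≢ y → ∃ λ p → Canonical p × SameLine (x , y) p
    canonical-cover {i , a} {j , b} x≢y with i ≟ᶠ j
    canonical-cover {i , a} {j , b} x≢y | no i≢j with <-cmp i j
    ... | tri< i<j _ _ = _ , across i<j , line-across-parts i≢j (<⇒≢ i<j) refl refl
    ... | tri≈ _ i≡j _ = ⊥-elim (i≢j i≡j)
    ... | tri> _ _ j<i = _ , across j<i ,
        SameLine-trans (line-sym x≢y) (line-across-parts (λ j≡i → i≢j (sym j≡i)) (<⇒≢ j<i) refl refl)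
    canonical-cover {i , a} {i , b} x≢y | yes refl with <-cmp a b
    ... | tri< a<b _ _ = _ , within a<b , λ z → ⇔-id _
    ... | tri≈ _ a≡b _ = ⊥-elim (x≢y (cong (i ,_) a≡b))
    ... | tri> _ _ b<a = _ , within b<a , line-sym x≢y

    acrossLine-injective : {i j i′ j′ : Fin k} → i < j → i′ < j′ →
      SameLine ((i , v₀ i) , (j , v₀ j)) ((i′ , v₀ i′) , (j′ , v₀ j′)) → i ≡ i′ × j ≡ j′
    acrossLine-injective {i} {j} {i′} {j′} i<j i′<j′ p∼q =
      <-pair-unique i<j i′<j′ (part (i , v₀ i) (inj₁ refl)) (part (j , v₀ j) (inj₂ (inj₁ refl)))
      where
      part : ∀ z → LineOf ((i , v₀ i) , (j , v₀ j)) z → proj₁ z ≡ i′ ⊎ proj₁ z ≡ j′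
      part z = Equivalence.to (line-across (<⇒≢ i′<j′) z) ∘ Equivalence.to (p∼q z)

    withinLine-injective : {i : Fin k} {a b a′ b′ : Fin (ns i)} → a < b → a′ < b′ →
      SameLine ((i , a) , (i , b)) ((i , a′) , (i , b′)) → a ≡ a′ × b ≡ b′
    withinLine-injective {i} {a} {b} {a′} {b′} a<b a′<b′ p∼q =
      <-pair-unique a<b a′<b′ (endpoint a (inj₁ refl)) (endpoint b (inj₂ (inj₁ refl)))
      where
      endpoint : ∀ c → LineOf ((i , a) , (i , b)) (i , c) → c ≡ a′ ⊎ c ≡ b′
      endpoint c = Sum.[ inj₁ ∘ vertex-injectiveʳ , Sum.[ inj₂ ∘ vertex-injectiveʳ , (λ i≢i → ⊥-elim (i≢i refl)) ] ]
               ∘ Equivalence.to (line-within (<⇒≢ a′<b′ ∘ vertex-injectiveʳ) refl (i , c))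
               ∘ Equivalence.to (p∼q (i , c))

    -- A third vertex of part i′ lies on the first line but not on the second.
    within≁within : {i i′ : Fin k} {a b : Fin (ns i)} {a′ b′ : Fin (ns i′)} → ns i′ ≢ 2 →
      a < b → a′ < b′ → i ≢ i′ → ¬ SameLine ((i , a) , (i , b)) ((i′ , a′) , (i′ , b′))
    within≁within {i} {i′} {a} {b} {a′} {b′} ns≢2 a<b a′<b′ i≢i′ p∼q with third-element a′ b′ (<⇒≢ a′<b′) ns≢2
    ... | c , c≢a′ , c≢b′ =
      Sum.[ c≢a′ ∘ vertex-injectiveʳ , Sum.[ c≢b′ ∘ vertex-injectiveʳ , (λ i′≢i′ → i′≢i′ refl) ] ]
      (Equivalence.to (line-within (<⇒≢ a′<b′ ∘ vertex-injectiveʳ) refl (i′ , c))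
        (Equivalence.to (p∼q (i′ , c)) c∈p))
      where
      c∈p : LineOf ((i , a) , (i , b)) (i′ , c)
      c∈p = Equivalence.from (line-within (<⇒≢ a<b ∘ vertex-injectiveʳ) refl (i′ , c)) (inj₂ (inj₂ i≢i′))

    -- A third part r separates them: the second line contains part r, the first misses it.
    across≁within : {i j i′ : Fin k} {a b : Fin (ns i′)} → k ≢ 2 → i < j → a < b →
      ¬ SameLine ((i , v₀ i) , (j , v₀ j)) ((i′ , a) , (i′ , b))
    across≁within {i} {j} {i′} {a} {b} k≢2 i<j a<b p∼q with third-element i j (<⇒≢ i<j) k≢2
    ... | r , r≢i , r≢j = Sum.[ r≢i , r≢j ] (parts (r , v₀ r) r∈q)
      where
      parts : ∀ z → LineOf ((i′ , a) , (i′ , b)) z → proj₁ z ≡ i ⊎ proj₁ z ≡ j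
      parts z = Equivalence.to (line-across (<⇒≢ i<j) z) ∘ Equivalence.from (p∼q z)
      i′≢r : i′ ≢ r
      i′≢r i′≡r = Sum.[ (λ i′≡i → r≢i (trans (sym i′≡r) i′≡i)) , (λ i′≡j → r≢j (trans (sym i′≡r) i′≡j)) ]
                    (parts (i′ , a) (inj₁ refl))
      r∈q : LineOf ((i′ , a) , (i′ , b)) (r , v₀ r)
      r∈q = Equivalence.from (line-within (<⇒≢ a<b ∘ vertex-injectiveʳ) refl (r , v₀ r)) (inj₂ (inj₂ i′≢r))

    canonical-injective : k ≢ 2 → (∀ i → ns i ≢ 2) →
      {p q : V × V} → Canonical p → Canonical q → SameLine p q → p ≡ q
    canonical-injective _ _ (across i<j) (across i′<j′) p∼q with acrossLine-injective i<j i′<j′ p∼q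
    ... | refl , refl = refl
    canonical-injective k≢2 _ (across i<j) (within a<b) p∼q = ⊥-elim (across≁within k≢2 i<j a<b p∼q)
    canonical-injective k≢2 _ (within a<b) (across i<j) p∼q =
      ⊥-elim (across≁within k≢2 i<j a<b (λ z → ⇔-sym (p∼q z)))
    canonical-injective _ ns≢2 (within {i} a<b) (within {i′} a′<b′) p∼q with i ≟ᶠ i′
    ... | no i≢i′ = ⊥-elim (within≁within (ns≢2 i′) a<b a′<b′ i≢i′ p∼q)
    ... | yes refl with withinLine-injective a<b a′<b′ p∼q
    ...   | refl , refl = refl

    acrossPairs : List (V × V)
    acrossPairs = map (λ (i , j) → (i , v₀ i) , (j , v₀ j)) (pairs k)

    withinPairs : (i : Fin k) → List (V × V)
    withinPairs i = map (λ (a , b) → (i , a) , (i , b)) (pairs (ns i))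

    canonicalPairs : List (V × V)
    canonicalPairs = acrossPairs ++ concatMap withinPairs (allFin k)

    ∈-acrossPairs⁻ : {p : V × V} → p ∈ acrossPairs → ∃₂ λ i j → i < j × p ≡ ((i , v₀ i) , (j , v₀ j))
    ∈-acrossPairs⁻ p∈ with ∈-map⁻ _ p∈
    ... | (i , j) , ij∈ , p≡ = i , j , ∈-pairs⁻ k ij∈ , p≡

    ∈-withinPairs⁻ : {i : Fin k} {p : V × V} → p ∈ withinPairs i →
      ∃₂ λ a b → a < b × p ≡ ((i , a) , (i , b))
    ∈-withinPairs⁻ {i} p∈ with ∈-map⁻ _ p∈
    ... | (a , b) , ab∈ , p≡ = a , b , ∈-pairs⁻ (ns i) ab∈ , p≡

    ∈-canonicalPairs⁻ : {p : V × V} → p ∈ canonicalPairs → Canonical p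
    ∈-canonicalPairs⁻ p∈ with ∈-++⁻ acrossPairs p∈
    ... | inj₁ p∈across with ∈-acrossPairs⁻ p∈across
    ...   | _ , _ , i<j , refl = across i<j
    ∈-canonicalPairs⁻ p∈ | inj₂ p∈within with find (∈-concatMap⁻ withinPairs {xs = allFin k} p∈within)
    ...   | _ , _ , p∈withinᵢ with ∈-withinPairs⁻ p∈withinᵢ
    ...     | _ , _ , a<b , refl = within a<b

    ∈-canonicalPairs⁺ : {p : V × V} → Canonical p → p ∈ canonicalPairs
    ∈-canonicalPairs⁺ (across i<j) = ∈-++⁺ˡ (∈-map⁺ _ (∈-pairs⁺ k i<j))
    ∈-canonicalPairs⁺ (within {i} a<b) =
      ∈-++⁺ʳ acrossPairs (∈-concatMap⁺ withinPairs (lose (∈-allFin i) (∈-map⁺ _ (∈-pairs⁺ (ns i) a<b))))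

    canonicalPairs-unique : Unique canonicalPairs
    canonicalPairs-unique =
      Unique.++⁺ (Unique.map⁺ acrossPair-injective (pairs-unique k))
                 (concatMap-unique withinPairs withinPairs-unique withinPairs-disjoint (Unique.allFin⁺ k))
                 across#within
      where
      acrossPair-injective : {ij ij′ : Fin k × Fin k} →
        _≡_ {A = V × V} ((proj₁ ij , v₀ (proj₁ ij)) , (proj₂ ij , v₀ (proj₂ ij)))
                        ((proj₁ ij′ , v₀ (proj₁ ij′)) , (proj₂ ij′ , v₀ (proj₂ ij′))) → ij ≡ ij′
      acrossPair-injective {_ , _} {_ , _} refl = refl
      withinPair-injective : ∀ {i} {ab ab′ : Fin (ns i) × Fin (ns i)} →
        _≡_ {A = V × V} ((i , proj₁ ab) , (i , proj₂ ab)) ((i , proj₁ ab′) , (i , proj₂ ab′)) → ab ≡ ab′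
      withinPair-injective {_} {_ , _} {_ , _} refl = refl
      withinPairs-unique : ∀ i → Unique (withinPairs i)
      withinPairs-unique i = Unique.map⁺ withinPair-injective (pairs-unique (ns i))
      withinPairs-disjoint : ∀ {i i′} → i ≢ i′ → Disjoint (withinPairs i) (withinPairs i′)
      withinPairs-disjoint i≢i′ (p∈ , p∈′) with ∈-withinPairs⁻ p∈ | ∈-withinPairs⁻ p∈′
      ... | _ , _ , _ , refl | _ , _ , _ , p≡ = i≢i′ (cong (proj₁ ∘ proj₁) p≡)
      across#within : Disjoint acrossPairs (concatMap withinPairs (allFin k))
      across#within (p∈ , p∈′) with ∈-acrossPairs⁻ p∈ | find (∈-concatMap⁻ withinPairs {xs = allFin k} p∈′)
      ... | _ , _ , i<j , refl | _ , _ , p∈withinᵢ with ∈-withinPairs⁻ p∈withinᵢ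
      ...   | _ , _ , _ , p≡ = <⇒≢ i<j (trans (cong (proj₁ ∘ proj₁) p≡) (sym (cong (proj₁ ∘ proj₂) p≡)))

    length-canonicalPairs : length canonicalPairs ≡ k C 2 + Σ[ k ] (λ i → ns i C 2)
    length-canonicalPairs = begin
      length (acrossPairs ++ concatMap withinPairs (allFin k))
        ≡⟨ length-++ acrossPairs ⟩
      length acrossPairs + length (concatMap withinPairs (allFin k))
        ≡⟨ cong₂ _+_ (trans (length-map _ (pairs k)) (length-pairs k)) (length-concatMap withinPairs (allFin k)) ⟩
      k C 2 + sum (map (length ∘ withinPairs) (allFin k))
        ≡⟨ cong (λ xs → k C 2 + sum xs) (map-cong (λ i → trans (length-map _ (pairs (ns i))) (length-pairs (ns i))) (allFin k)) ⟩
      k C 2 + Σ[ k ] (λ i → ns i C 2) ∎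
      where open ≡-Reasoning

    NumLines-canonical : k ≢ 2 → (∀ i → ns i ≢ 2) → NumLines {k} {ns} (k C 2 + Σ[ k ] (λ i → ns i C 2))
    NumLines-canonical k≢2 ns≢2 =
      subst NumLines length-canonicalPairs
        (NumLines-fromList canonicalPairs canonicalPairs-unique
          (canonical-distinct ∘ ∈-canonicalPairs⁻)
          (λ p∈ q∈ → canonical-injective k≢2 ns≢2 (∈-canonicalPairs⁻ p∈) (∈-canonicalPairs⁻ q∈))
          (λ x≢y → let p , can , xy∼p = canonical-cover x≢y in p , ∈-canonicalPairs⁺ can , xy∼p))

FullLine-of-two-parts : {k : ℕ} {ns : Fin k → ℕ} → ((i : Fin k) → Fin (ns i)) → k ≡ 2 → FullLine {k} {ns}
FullLine-of-two-parts v₀ refl =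
  (zero , v₀ zero) , (suc zero , v₀ (suc zero)) , (λ ()) ,
  λ z → Equivalence.from (line-across (λ ()) z) (part z)
  where
  part : ∀ z → proj₁ z ≡ zero ⊎ proj₁ z ≡ suc zero
  part (zero , _)     = inj₁ refl
  part (suc zero , _) = inj₂ refl

-- Vertex and line counts

module _ {k : ℕ} (ns : Fin k → ℕ) where

  private
    n ΣC2 N s : ℕ
    n   = Σ[ k ] ns
    ΣC2 = Σ[ k ] (λ i → ns i C 2)
    N   = k C 2 + ΣC2
    s   = Σ[ k ] (λ i → ns i * ns i)
    length-allFin : length (allFin k) ≡ k
    length-allFin = length-tabulate (λ i → i)
    k-ones : Σ[ k ] (λ _ → 1) ≡ k
    k-ones = trans (sum-map-const 1 (allFin k)) (trans (*-identityʳ _) length-allFin)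

  Σ≤kC2+ΣC2 : 3 ≤ k → n ≤ N
  Σ≤kC2+ΣC2 3≤k = begin
    n                             ≤⟨ sum-map-mono (λ i → n≤nC2+1 (ns i)) (allFin k) ⟩
    Σ[ k ] (λ i → ns i C 2 + 1)   ≡⟨ sum-map-+ (λ i → ns i C 2) (λ _ → 1) (allFin k) ⟩
    ΣC2 + Σ[ k ] (λ _ → 1)        ≡⟨ cong (ΣC2 +_) k-ones ⟩
    ΣC2 + k                       ≤⟨ +-monoʳ-≤ ΣC2 (3≤n⇒n≤nC2 3≤k) ⟩
    ΣC2 + k C 2                   ≡⟨ +-comm ΣC2 (k C 2) ⟩
    N                             ∎
    where open ≤-Reasoning

  Σ*Σ≤k*Σ² : n * n ≤ k * s
  Σ*Σ≤k*Σ² = subst (λ l → n * n ≤ l * s) length-allFin (cauchy-schwarz ns (allFin k))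

  k²+Σ²≤2[N+Σ] : (∀ i → 1 ≤ ns i) → k * k + s ≤ 2 * (N + n)
  k²+Σ²≤2[N+Σ] pos = +-cancelʳ-≤ k _ _ (begin
    k * k + s + k                                    ≤⟨ +-monoʳ-≤ (k * k + s) k≤n ⟩
    k * k + s + n                                    ≡⟨ cong₂ (λ a b → a + b + n) (2*nC2+n≡n*n k) 2*ΣC2+Σ≡Σ² ⟨
    (2 * (k C 2) + k) + (2 * ΣC2 + n) + n             ≡⟨ regroup (k C 2) ΣC2 n k ⟨
    2 * (N + n) + k                                  ∎)
    where
    open ≤-Reasoning
    k≤n : k ≤ n
    k≤n = subst (_≤ n) k-ones (sum-map-mono pos (allFin k))
    2*ΣC2+Σ≡Σ² : 2 * ΣC2 + n ≡ s
    2*ΣC2+Σ≡Σ² = begin-equality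
      2 * ΣC2 + n                                ≡⟨ cong (_+ n) (sum-map-*ˡ 2 (λ i → ns i C 2) (allFin k)) ⟨
      Σ[ k ] (λ i → 2 * (ns i C 2)) + n          ≡⟨ sum-map-+ (λ i → 2 * (ns i C 2)) ns (allFin k) ⟨
      Σ[ k ] (λ i → 2 * (ns i C 2) + ns i)       ≡⟨ cong sum (map-cong (λ i → 2*nC2+n≡n*n (ns i)) (allFin k)) ⟩
      s                                          ∎
    regroup : ∀ c σ n k → 2 * (c + σ + n) + k ≡ (2 * c + k) + (2 * σ + n) + n
    regroup = solve-∀

mainTheorem3 : (k : ℕ) (ns : Fin k → ℕ) → 2 ≤ k → (∀ i → 1 ≤ ns i) →
    (∀ (x y : Vtx k ns) → x ≢ y → ¬ (∀ z → InLine x y z)) →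
    3 ≤ k × (∀ i → ns i ≢ 2) ×
    ∃ λ N → NumLines {k} {ns} N ×
      N ≡ k C 2 + (Σ[ k ] (λ i → ns i C 2)) ×
      (Σ[ k ] ns) ≤ N ×
      27 * (Σ[ k ] ns) ^ 4 ≤ 32 * (N + Σ[ k ] ns) ^ 3
mainTheorem3 k ns 2≤k pos noFullLine =
  3≤k , ns≢2 , N , NumLines-canonical v₀ k≢2 ns≢2 , refl , Σ≤kC2+ΣC2 ns 3≤k ,
  27*n⁴≤32*M³ k n (Σ[ k ] (λ i → ns i * ns i)) (N + n) {{>-nonZero (≤-trans (s≤s z≤n) 3≤k)}}
    (Σ*Σ≤k*Σ² ns) (k²+Σ²≤2[N+Σ] ns pos)
  where
  n N : ℕ
  n = Σ[ k ] ns
  N = k C 2 + Σ[ k ] (λ i → ns i C 2)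
  v₀ : (i : Fin k) → Fin (ns i)
  v₀ i = fromℕ< (pos i)
  noFull : ¬ FullLine {k} {ns}
  noFull (x , y , x≢y , full) = noFullLine x y x≢y full
  k≢2 : k ≢ 2
  k≢2 = noFull ∘ FullLine-of-two-parts v₀
  ns≢2 : ∀ i → ns i ≢ 2
  ns≢2 i = noFull ∘ FullLine-of-pair-part i
  3≤k : 3 ≤ k
  3≤k = ≤∧≢⇒< 2≤k (k≢2 ∘ sym)
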